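{- Let $m,a,b,n$ be positive integers with $n\ge 3$ and $(3m+1)/2\le a<b\le(5m-1)/3$. Let $A\subset\mathbb N_+$ be a subset with $|A|=n-1$, $\min A=a$, $\max A=b$, which induces a $B_3$ set in $\mathbb Z/m\mathbb Z$. Let $S=\langle\{m\}\cup A\rangle_{4m}$. Then $W(S)\ge 9$.
   Context: $\mathbb N=\{0,1,2,\dots\}$, $\mathbb N_+=\mathbb N\setminus\{0\}$. A numerical semigroup is a submonoid $S\subseteq\mathbb N$ (containing $0$ and closed under addition) with finite complement in $\mathbb N$. Let $S^*=S\setminus\{0\}$. The conductor $c$ of $S$ is the least integer with $c+\mathbb N\subseteq S$. Let $P$ be the set of primitive elements of $S$ (elements of $S^*$ not expressible as $a_1+a_2$ with $a_1,a_2\in S^*$), $L=S\cap\{0,1,\dots,c-1\}$, and $W(S)=|P||L|-c$. For a finite set $B$ of positive integers and a positive integer $t$, $\langle B\rangle_t$ denotes the set of all finite $\mathbb N$-linear combinations of elements of $B$, together with all integers $\ge t$; it is a numerical semigroup. A set $A\subset\mathbb Z$ induces a $B_3$ set in $\mathbb Z/m\mathbb Z$ if its image in $\mathbb Z/m\mathbb Z$ has $|A|$ elements and for all $a_1,a_2,a_3,b_1,b_2,b_3\in A$, $a_1+a_2+a_3\equiv b_1+b_2+b_3\pmod m$ holds only if $(a_1,a_2,a_3)$ is a permutation of $(b_1,b_2,b_3)$. -}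

module Defs where

open import Data.Nat using (ℕ; zero; suc; _+_; _*_; _≤_; _<_; NonZero)
open import Data.Nat.DivMod using (_%_)
open import Data.List using (List; _∷_; []; length)
open import Data.List.Membership.Propositional using (_∈_)
open import Data.List.Relation.Unary.Unique.Propositional using (Unique)
open import Data.List.Relation.Binary.Permutation.Propositional using (_↭_)
open import Data.Product using (_×_; ∃; ∃-syntax)
open import Data.Sum using (_⊎_)
open import Relation.Nullary using (¬_)
open import Relation.Binary.PropositionalEquality using (_≡_)

data Comb (gs : List ℕ) : ℕ → Set where
  comb-zero : Comb gs 0
  comb-add  : ∀ {g x} → g ∈ gs → Comb gs x → Comb gs (g + x)

⟨_⟩[_] : List ℕ → ℕ → ℕ → Set
⟨ gs ⟩[ t ] x = Comb gs x ⊎ t ≤ x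

IsConductor : (ℕ → Set) → ℕ → Set
IsConductor S c =
  (∀ x → c ≤ x → S x) × (∀ c' → (∀ x → c' ≤ x → S x) → c ≤ c')

Primitive : (ℕ → Set) → ℕ → Set
Primitive S x =
  S x × 0 < x ×
  ¬ (∃[ a₁ ] ∃[ a₂ ] (S a₁ × 0 < a₁ × S a₂ × 0 < a₂ × x ≡ a₁ + a₂))

SmallElt : (ℕ → Set) → ℕ → ℕ → Set
SmallElt S c x = S x × x < c

-- xs is a duplicate-free list enumerating exactly the set P (so |P| = length xs)
Enumerates : List ℕ → (ℕ → Set) → Set
Enumerates xs P = Unique xs × (∀ x → (x ∈ xs → P x) × (P x → x ∈ xs))

-- W(S) ≥ k, i.e. |P|·|L| − c ≥ k, with |P|,|L| given by enumerations
W≥ : (ℕ → Set) → ℕ → Set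
W≥ S k = ∀ c ps ls → IsConductor S c → Enumerates ps (Primitive S) →
         Enumerates ls (SmallElt S c) → c + k ≤ length ps * length ls

InducesB₃ : (m : ℕ) → .{{NonZero m}} → List ℕ → Set
InducesB₃ m A =
  (∀ {x y} → x ∈ A → y ∈ A → x % m ≡ y % m → x ≡ y) ×
  (∀ {a₁ a₂ a₃ b₁ b₂ b₃} → a₁ ∈ A → a₂ ∈ A → a₃ ∈ A → b₁ ∈ A → b₂ ∈ A → b₃ ∈ A →
     (a₁ + a₂ + a₃) % m ≡ (b₁ + b₂ + b₃) % m →
     (a₁ ∷ a₂ ∷ a₃ ∷ []) ↭ (b₁ ∷ b₂ ∷ b₃ ∷ []))

module Submission where

-- Write k = |A| ≥ 2 and call x representable if it is an ℕ-combination of m and A.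
-- Every element of A exceeds 3m/2, so a representable x < 5m has one of the shapes
-- i·m (i ≤ 4), i·m + y (i ≤ 3), i·m + y + z (i ≤ 1), y + z + w  (y, z, w ∈ A).
-- From this classification:
--  * 2m+b+1 is a gap of S, hence the conductor c satisfies 2m+b+1 < c ≤ 4m, and
--    L contains the 5+4k distinct elements 0, m, A, 2m, m+A, 3m, a+A, 2b, 2m+A;
--  * m and A are primitive, and so is every non-representable x ∈ (4m, 5m), since a
--    sum of two nonzero elements of S is ≥ 5m;
--  * a representable x ∈ (4m, 5m) lies in D = (3m+A) ∪ (m+A+A) ∪ (A+A+A), a set of
--    at most k + k(k+1)/2 + k(k+1)(k+2)/6 values, and misses the three "bands"
--    (4m, m+2a), (m+2b, 3m+a), (3b, 5m), whose total length I satisfies 6I ≥ m+1.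
-- So |P| ≥ 1 + k + I, |P| ≥ 1 + k + (m-1-|D|) and |L| ≥ 5+4k, and an arithmetic case
-- analysis on k gives |P|·|L| ≥ 4m+9 ≥ c+9.

open import Defs
open import Data.Nat using (ℕ; zero; suc; _+_; _*_; _∸_; _≤_; _<_; z≤n; s≤s; NonZero; _≤?_)
open import Data.Nat.Properties
open import Data.Nat.Tactic.RingSolver using (solve; solve-∀)
open import Data.List using (List; _∷_; []; [_]; length; _++_; map; filter; applyUpTo)
open import Data.List.Properties using (length-++; length-map; length-applyUpTo)
open import Data.List.Membership.Propositional using (_∈_; _∉_)
open import Data.List.Membership.Propositional.Properties
open import Data.List.Membership.DecPropositional _≟_ using (_∈?_)
open import Data.List.Relation.Unary.Any using (here; there)
open import Data.List.Relation.Unary.All as All using (All)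
import Data.List.Relation.Unary.All.Properties as AllP
import Data.List.Relation.Unary.AllPairs as AllPairs
open import Data.List.Relation.Unary.Unique.Propositional using (Unique)
import Data.List.Relation.Unary.Unique.Propositional.Properties as UniqueP
open import Data.Product using (_×_; _,_; ∃-syntax; proj₁; proj₂)
open import Data.Sum using (_⊎_; inj₁; inj₂)
open import Data.Empty using (⊥; ⊥-elim)
open import Relation.Nullary using (¬_; Dec; yes; no; ¬?)
open import Relation.Binary.PropositionalEquality
  using (_≡_; _≢_; refl; sym; trans; cong; cong₂; subst; subst₂; module ≡-Reasoning)

<-≤-≤-absurd : ∀ {x y z : ℕ} → x < y → y ≤ z → z ≤ x → ⊥
<-≤-≤-absurd x<y y≤z z≤x = <-irrefl refl (≤-trans x<y (≤-trans y≤z z≤x))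

≥-via : ∀ {x e l : ℕ} → x ≡ e → l ≤ e → l ≤ x
≥-via refl l≤e = l≤e

≤-via : ∀ {x e u : ℕ} → x ≡ e → e ≤ u → x ≤ u
≤-via refl e≤u = e≤u

≤-suc-cases : ∀ {i n} → i ≤ suc n → i ≤ n ⊎ i ≡ suc n
≤-suc-cases i≤1+n with m≤n⇒m<n∨m≡n i≤1+n
... | inj₁ (s≤s i≤n) = inj₁ i≤n
... | inj₂ i≡1+n     = inj₂ i≡1+n

+-left-swap : ∀ x y z → x + (y + z) ≡ y + (x + z)
+-left-swap x y z = trans (sym (+-assoc x y z)) (trans (cong (_+ z) (+-comm x y)) (+-assoc y x z))

∈-remove : ∀ {z x : ℕ} us {vs} → z ∈ us ++ x ∷ vs → z ≢ x → z ∈ us ++ vs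
∈-remove []       (here refl) z≢x = ⊥-elim (z≢x refl)
∈-remove []       (there p)   _   = p
∈-remove (u ∷ us) (here refl) _   = here refl
∈-remove (u ∷ us) (there p)   z≢x = there (∈-remove us p z≢x)

length-mono-⊆ : ∀ {xs ys : List ℕ} → Unique xs → (∀ {x} → x ∈ xs → x ∈ ys) →
                length xs ≤ length ys
length-mono-⊆ {[]}     _           _  = z≤n
length-mono-⊆ {x ∷ xs} u xs⊆ys with ∈-∃++ (xs⊆ys (here refl))
... | us , vs , refl = begin
  suc (length xs)          ≤⟨ s≤s (length-mono-⊆ (AllPairs.tail u) xs⊆us++vs) ⟩
  suc (length (us ++ vs))  ≡⟨ cong suc (length-++ us) ⟩
  suc (length us + length vs) ≡⟨ +-suc (length us) (length vs) ⟨
  length us + length (x ∷ vs) ≡⟨ length-++ us ⟨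
  length (us ++ x ∷ vs)    ∎
  where
  open ≤-Reasoning
  xs⊆us++vs : ∀ {z} → z ∈ xs → z ∈ us ++ vs
  xs⊆us++vs z∈xs = ∈-remove us (xs⊆ys (there z∈xs)) (λ { refl → All.lookup (AllPairs.head u) z∈xs refl })

length-map-++ : ∀ (f : ℕ → ℕ) xs {ys} → length (map f xs ++ ys) ≡ length xs + length ys
length-map-++ f xs {ys} = trans (length-++ (map f xs)) (cong (_+ length ys) (length-map f xs))

enumeration-bound : ∀ {P : ℕ → Set} {ps xs} → Enumerates ps P → Unique xs → All P xs →
                    length xs ≤ length ps
enumeration-bound (_ , enum) u Pxs =
  length-mono-⊆ u (λ {x} x∈xs → proj₂ (enum x) (All.lookup Pxs x∈xs))

_∉?_ : (x : ℕ) (D : List ℕ) → Dec (x ∉ D)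
x ∉? D = ¬? (x ∈? D)

outside : List ℕ → List ℕ → List ℕ
outside D = filter (_∉? D)

length-outside : ∀ D {xs} → Unique xs → length xs ≤ length (outside D xs) + length D
length-outside D {xs} u =
  subst (length xs ≤_) (length-++ (outside D xs)) (length-mono-⊆ u covered)
  where
  covered : ∀ {x} → x ∈ xs → x ∈ outside D xs ++ D
  covered {x} x∈xs with x ∈? D
  ... | yes x∈D = ∈-++⁺ʳ (outside D xs) x∈D
  ... | no  x∉D = ∈-++⁺ˡ (∈-filter⁺ (_∉? D) x∈xs x∉D)

-- Lists assembled from blocks with increasing ranges are duplicate-free;
-- this is how the large families of elements of P and L are counted.
record Block (lo hi : ℕ) (xs : List ℕ) : Set where
  field
    lo≤hi  : lo ≤ hi
    unique : Unique xs
    range  : ∀ {x} → x ∈ xs → lo ≤ x × x < hi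
open Block

single : ∀ x → Block x (suc x) [ x ]
single x = record
  { lo≤hi = n≤1+n x ; unique = All.[] AllPairs.∷ AllPairs.[] ; range = λ { (here refl) → ≤-refl , ≤-refl } }

infixr 5 _⧺⟨_⟩_

_⧺⟨_⟩_ : ∀ {l₁ h₁ l₂ h₂ xs ys} → Block l₁ h₁ xs → h₁ ≤ l₂ → Block l₂ h₂ ys →
         Block l₁ h₂ (xs ++ ys)
_⧺⟨_⟩_ {l₁} {h₁} {l₂} {h₂} {xs} {ys} B h₁≤l₂ C = record
  { lo≤hi = ≤-trans l₁≤l₂ (lo≤hi C)
  ; unique = UniqueP.++⁺ (unique B) (unique C) apart
  ; range = range++ }
  where
  l₁≤l₂ : l₁ ≤ l₂
  l₁≤l₂ = ≤-trans (lo≤hi B) h₁≤l₂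
  apart : ∀ {v} → ¬ (v ∈ xs × v ∈ ys)
  apart (p , q) = <-irrefl refl (≤-trans (proj₂ (range B p)) (≤-trans h₁≤l₂ (proj₁ (range C q))))
  range++ : ∀ {x} → x ∈ xs ++ ys → l₁ ≤ x × x < h₂
  range++ p with ∈-++⁻ xs p
  ... | inj₁ q = proj₁ (range B q) , <-≤-trans (proj₂ (range B q)) (≤-trans h₁≤l₂ (lo≤hi C))
  ... | inj₂ q = ≤-trans l₁≤l₂ (proj₁ (range C q)) , proj₂ (range C q)

shift : ∀ d {lo hi xs} → Block lo hi xs → Block (d + lo) (d + hi) (map (d +_) xs)
shift d {xs = xs} B = record
  { lo≤hi = +-monoʳ-≤ d (lo≤hi B)
  ; unique = UniqueP.map⁺ (+-cancelˡ-≡ d _ _) (unique B)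
  ; range = range-shift }
  where
  range-shift : ∀ {x} → x ∈ map (d +_) xs → d + _ ≤ x × x < d + _
  range-shift p with y , y∈xs , refl ← ∈-map⁻ (d +_) p =
    +-monoʳ-≤ d (proj₁ (range B y∈xs)) , +-monoʳ-< d (proj₂ (range B y∈xs))

outside-block : ∀ D {lo hi xs} → Block lo hi xs → Block lo hi (outside D xs)
outside-block D {xs = xs} B = record
  { lo≤hi = lo≤hi B
  ; unique = UniqueP.filter⁺ (_∉? D) (unique B)
  ; range = λ p → range B (proj₁ (∈-filter⁻ (_∉? D) {xs = xs} p)) }

interval : ℕ → ℕ → List ℕ
interval lo hi = applyUpTo (lo +_) (hi ∸ lo)

∈-interval⁻ : ∀ {lo hi x} → x ∈ interval lo hi → lo ≤ x × x < hi
∈-interval⁻ {lo} {hi} p with i , i<hi∸lo , refl ← ∈-applyUpTo⁻ (lo +_) p =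
  m≤m+n lo i ,
  subst (lo + i <_) (m+[n∸m]≡n {lo} {hi} (<⇒≤ (m∸n≢0⇒n<m (m<n⇒n≢0 i<hi∸lo)))) (+-monoʳ-< lo i<hi∸lo)

length-interval : ∀ lo hi → length (interval lo hi) ≡ hi ∸ lo
length-interval lo hi = length-applyUpTo (lo +_) (hi ∸ lo)

interval-block : ∀ {lo hi} → lo ≤ hi → Block lo hi (interval lo hi)
interval-block {lo} {hi} lo≤hi = record
  { lo≤hi = lo≤hi
  ; unique = UniqueP.applyUpTo⁺₁ (lo +_) (hi ∸ lo) (λ i<j _ e → <⇒≢ i<j (+-cancelˡ-≡ lo _ _ e))
  ; range = ∈-interval⁻ }

-- All sums x + y (resp. x + y + z) with x, y (, z) taken from xs with
-- non-increasing positions, i.e. one entry per multiset of size 2 (resp. 3).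
pairSums : List ℕ → List ℕ
pairSums []       = []
pairSums (x ∷ xs) = map (x +_) (x ∷ xs) ++ pairSums xs

tripleSums : List ℕ → List ℕ
tripleSums []       = []
tripleSums (x ∷ xs) = map (x +_) (pairSums (x ∷ xs)) ++ tripleSums xs

pairCount : ℕ → ℕ
pairCount zero    = 0
pairCount (suc k) = suc k + pairCount k

tripleCount : ℕ → ℕ
tripleCount zero    = 0
tripleCount (suc k) = pairCount (suc k) + tripleCount k

length-pairSums : ∀ xs → length (pairSums xs) ≡ pairCount (length xs)
length-pairSums []       = refl
length-pairSums (x ∷ xs) = trans (length-++ (map (x +_) (x ∷ xs)))
  (cong₂ _+_ (length-map (x +_) (x ∷ xs)) (length-pairSums xs))

length-tripleSums : ∀ xs → length (tripleSums xs) ≡ tripleCount (length xs)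
length-tripleSums []       = refl
length-tripleSums (x ∷ xs) = trans (length-++ (map (x +_) (pairSums (x ∷ xs))))
  (cong₂ _+_ (trans (length-map (x +_) (pairSums (x ∷ xs))) (length-pairSums (x ∷ xs)))
             (length-tripleSums xs))

∈-pairSums : ∀ {y z} xs → y ∈ xs → z ∈ xs → y + z ∈ pairSums xs
∈-pairSums (x ∷ xs) (here refl) q = ∈-++⁺ˡ (∈-map⁺ (x +_) q)
∈-pairSums {y} (x ∷ xs) (there p) (here refl) =
  subst (_∈ pairSums (x ∷ xs)) (+-comm x y) (∈-++⁺ˡ (∈-map⁺ (x +_) (there p)))
∈-pairSums (x ∷ xs) (there p) (there q) =
  ∈-++⁺ʳ (map (x +_) (x ∷ xs)) (∈-pairSums xs p q)

∈-tripleSums : ∀ {y z w} xs → y ∈ xs → z ∈ xs → w ∈ xs → y + (z + w) ∈ tripleSums xs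
∈-tripleSums (x ∷ xs) (here refl) q r = ∈-++⁺ˡ (∈-map⁺ (x +_) (∈-pairSums (x ∷ xs) q r))
∈-tripleSums {y} {z} {w} (x ∷ xs) (there p) (here refl) r =
  subst (_∈ tripleSums (x ∷ xs)) (+-left-swap x y w)
    (∈-++⁺ˡ (∈-map⁺ (x +_) (∈-pairSums (x ∷ xs) (there p) r)))
∈-tripleSums {y} {z} {w} (x ∷ xs) (there p) (there q) (here refl) =
  subst (_∈ tripleSums (x ∷ xs)) (trans (+-comm x (y + z)) (+-assoc y z x))
    (∈-++⁺ˡ (∈-map⁺ (x +_) (∈-pairSums (x ∷ xs) (there p) (there q))))
∈-tripleSums (x ∷ xs) (there p) (there q) (there r) =
  ∈-++⁺ʳ (map (x +_) (pairSums (x ∷ xs))) (∈-tripleSums xs p q r)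

-- A certificate for X ≤ Y: a valid inequality L ≤ R (a nonnegative combination of
-- hypotheses) with c·X + R + w = c·Y + L as polynomials.  The identity is checked
-- by the ring solver, which turns every linear consequence below into one line.
cert : ∀ {X Y L R : ℕ} (c : ℕ) .{{_ : NonZero c}} (w : ℕ) → L ≤ R →
       c * X + R + w ≡ c * Y + L → X ≤ Y
cert {X} {Y} {L} {R} c w L≤R eq = *-cancelˡ-≤ c (+-cancelʳ-≤ L (c * X) (c * Y)
  (≤-trans (+-monoʳ-≤ (c * X) L≤R) (subst (c * X + R ≤_) eq (m≤m+n (c * X + R) w))))

infixl 6 _⊕_
_⊕_ : ∀ {p q r s} → p ≤ q → r ≤ s → p + r ≤ q + s
_⊕_ = +-mono-≤

sc : ∀ k {p q} → p ≤ q → k * p ≤ k * q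
sc k = *-monoʳ-≤ k

-- The final count: with k ≥ 2 elements in A, |L| ≥ 5 + 4k, and the two lower
-- bounds on |P| (bands of total length I, and F elements of (4m,5m) outside D),
-- |P|·|L| ≥ 4m + 9.  For k ≥ 5 the band bound suffices; for k = 2, 3, 4 one of the
-- two bounds applies according to the size of m.
final-count : ∀ (m k P L F I : ℕ) → 2 ≤ k → suc m ≤ 6 * I → suc (k + I) ≤ P →
  suc (k + F) ≤ P → m ≤ suc (F + (k + (pairCount k + tripleCount k))) → 5 + 4 * k ≤ L →
  4 * m + 9 ≤ P * L
final-count m 0 P L F I () _ _ _ _ _
final-count m 1 P L F I (s≤s ()) _ _ _ _ _
final-count m 2 P L F I _ 6I>m P≥I P≥F F≥ L≥ = ≤-trans count (*-monoʳ-≤ P L≥)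
  where
  count : 4 * m + 9 ≤ P * 13
  count with m ≤? 17
  ... | yes m≤17 = cert 6 6 (sc 78 P≥I ⊕ sc 13 6I>m ⊕ sc 11 m≤17) (solve (m ∷ P ∷ I ∷ F ∷ []))
  ... | no  m>17 = cert 1 62 (sc 13 P≥F ⊕ sc 13 F≥ ⊕ sc 9 (≰⇒> m>17)) (solve (m ∷ P ∷ I ∷ F ∷ []))
final-count m 3 P L F I _ 6I>m P≥I P≥F F≥ L≥ = ≤-trans count (*-monoʳ-≤ P L≥)
  where
  count : 4 * m + 9 ≤ P * 17
  count with m ≤? 40
  ... | yes m≤40 = cert 6 91 (sc 102 P≥I ⊕ sc 17 6I>m ⊕ sc 7 m≤40) (solve (m ∷ P ∷ I ∷ F ∷ []))
  ... | no  m>40 = cert 1 252 (sc 17 P≥F ⊕ sc 17 F≥ ⊕ sc 13 (≰⇒> m>40)) (solve (m ∷ P ∷ I ∷ F ∷ []))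
final-count m 4 P L F I _ 6I>m P≥I P≥F F≥ L≥ = ≤-trans count (*-monoʳ-≤ P L≥)
  where
  count : 4 * m + 9 ≤ P * 21
  count with m ≤? 100
  ... | yes m≤100 = cert 6 297 (sc 126 P≥I ⊕ sc 21 6I>m ⊕ sc 3 m≤100) (solve (m ∷ P ∷ I ∷ F ∷ []))
  ... | no  m>100 = cert 1 1078 (sc 21 P≥F ⊕ sc 21 F≥ ⊕ sc 17 (≰⇒> m>100)) (solve (m ∷ P ∷ I ∷ F ∷ []))
final-count m (suc (suc (suc (suc (suc j))))) P L F I _ 6I>m P≥I _ _ L≥ =
  ≤-trans count (*-monoʳ-≤ P (≤-trans (m≤m+n 25 (4 * j)) (≤-trans (≤-reflexive L-form) L≥)))
  where
  L-form : 25 + 4 * j ≡ 5 + 4 * suc (suc (suc (suc (suc j))))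
  L-form = solve (j ∷ [])
  P≥6+I : suc (5 + I) ≤ P
  P≥6+I = ≤-trans (s≤s (+-monoˡ-≤ I (s≤s (s≤s (s≤s (s≤s (s≤s z≤n))))))) P≥I
  count : 4 * m + 9 ≤ P * 25
  count = cert 6 (871 + m) (sc 150 P≥6+I ⊕ sc 25 6I>m) (solve (m ∷ P ∷ I ∷ F ∷ []))

module Semigroup (m a b : ℕ) (A : List ℕ)
  (hyp-a : 3 * m + 1 ≤ 2 * a) (a<b : a < b) (hyp-b : 3 * b + 1 ≤ 5 * m)
  (A-unique : Unique A) (a∈A : a ∈ A) (b∈A : b ∈ A)
  (a≤A : ∀ x → x ∈ A → a ≤ x) (A≤b : ∀ x → x ∈ A → x ≤ b) where

  abstract
    11≤m : 11 ≤ m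
    11≤m = cert 1 0 (sc 3 hyp-a ⊕ sc 6 a<b ⊕ sc 2 hyp-b) (solve (m ∷ a ∷ b ∷ []))
    0<m : 0 < m
    0<m = cert 1 10 (sc 1 11≤m) (solve (m ∷ a ∷ b ∷ []))
    m<a : m < a
    m<a = cert 1 5 (sc 2 hyp-a ⊕ sc 3 a<b ⊕ sc 1 hyp-b) (solve (m ∷ a ∷ b ∷ []))
    b<m+m : b < m + m
    b<m+m = cert 1 3 (sc 1 hyp-a ⊕ sc 2 a<b ⊕ sc 1 hyp-b) (solve (m ∷ a ∷ b ∷ []))
    b≤4m : b ≤ 4 * m
    b≤4m = cert 1 26 (sc 1 hyp-a ⊕ sc 2 a<b ⊕ sc 1 hyp-b ⊕ sc 2 11≤m) (solve (m ∷ a ∷ b ∷ []))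
    4m≤5m : 4 * m ≤ 5 * m
    4m≤5m = cert 1 11 (sc 1 11≤m) (solve (m ∷ a ∷ b ∷ []))
    -- an extra summand pushes the shapes of representable numbers past 5m
    5m≤m+[3m+a] : 5 * m ≤ m + (3 * m + a)
    5m≤m+[3m+a] = cert 1 6 (sc 2 hyp-a ⊕ sc 3 a<b ⊕ sc 1 hyp-b) (solve (m ∷ a ∷ b ∷ []))
    5m≤m+[m+2a] : 5 * m ≤ m + (1 * m + (a + a))
    5m≤m+[m+2a] = cert 1 1 (sc 1 hyp-a) (solve (m ∷ a ∷ b ∷ []))
    5m≤m+3a : 5 * m ≤ m + (a + (a + a))
    5m≤m+3a = cert 1 7 (sc 3 hyp-a ⊕ sc 3 a<b ⊕ sc 1 hyp-b) (solve (m ∷ a ∷ b ∷ []))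
    5m≤a+4m : 5 * m ≤ a + 4 * m
    5m≤a+4m = cert 1 6 (sc 2 hyp-a ⊕ sc 3 a<b ⊕ sc 1 hyp-b) (solve (m ∷ a ∷ b ∷ []))
    5m≤a+[2m+a] : 5 * m ≤ a + (2 * m + a)
    5m≤a+[2m+a] = cert 1 1 (sc 1 hyp-a) (solve (m ∷ a ∷ b ∷ []))
    5m≤a+[m+2a] : 5 * m ≤ a + (1 * m + (a + a))
    5m≤a+[m+2a] = cert 1 7 (sc 3 hyp-a ⊕ sc 3 a<b ⊕ sc 1 hyp-b) (solve (m ∷ a ∷ b ∷ []))
    5m≤4a : 5 * m ≤ a + (a + (a + a))
    5m≤4a = cert 1 13 (sc 2 hyp-a ⊕ sc 1 11≤m) (solve (m ∷ a ∷ b ∷ []))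
    2m+b≤4m : 2 * m + b ≤ 4 * m
    2m+b≤4m = cert 1 4 (sc 1 hyp-a ⊕ sc 2 a<b ⊕ sc 1 hyp-b) (solve (m ∷ a ∷ b ∷ []))
    b+b≤4m : b + b ≤ 4 * m
    b+b≤4m = cert 1 8 (sc 2 hyp-a ⊕ sc 4 a<b ⊕ sc 2 hyp-b) (solve (m ∷ a ∷ b ∷ []))
    3m+b≤3b : 3 * m + b ≤ b + (b + b)
    3m+b≤3b = cert 1 3 (sc 1 hyp-a ⊕ sc 2 a<b) (solve (m ∷ a ∷ b ∷ []))
    3m+a≤3a : 3 * m + a ≤ a + (a + a)
    3m+a≤3a = cert 1 1 (sc 1 hyp-a) (solve (m ∷ a ∷ b ∷ []))
    m+2a≤3m+a : m + (a + a) ≤ 3 * m + a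
    m+2a≤3m+a = cert 1 5 (sc 1 hyp-a ⊕ sc 3 a<b ⊕ sc 1 hyp-b) (solve (m ∷ a ∷ b ∷ []))
    m+2b≤3b : m + (b + b) ≤ b + (b + b)
    m+2b≤3b = cert 1 7 (sc 2 hyp-a ⊕ sc 4 a<b ⊕ sc 1 hyp-b) (solve (m ∷ a ∷ b ∷ []))
    3m≤2m+b : 3 * m ≤ m + (m + b)
    3m≤2m+b = cert 1 7 (sc 2 hyp-a ⊕ sc 4 a<b ⊕ sc 1 hyp-b) (solve (m ∷ a ∷ b ∷ []))
    gap<4m : m + (m + suc b) < 4 * m
    gap<4m = cert 1 2 (sc 1 hyp-a ⊕ sc 2 a<b ⊕ sc 1 hyp-b) (solve (m ∷ a ∷ b ∷ []))
    2m+b≤m+[m+b] : 2 * m + b ≤ m + (m + b)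
    2m+b≤m+[m+b] = cert 1 0 (z≤n {0}) (solve (m ∷ a ∷ b ∷ []))
    b+b≤m+[m+b] : b + b ≤ m + (m + b)
    b+b≤m+[m+b] = cert 1 4 (sc 1 hyp-a ⊕ sc 2 a<b ⊕ sc 1 hyp-b) (solve (m ∷ a ∷ b ∷ []))
    gap<3m+a : m + (m + suc b) < 3 * m + a
    gap<3m+a = cert 1 8 (sc 3 hyp-a ⊕ sc 5 a<b ⊕ sc 2 hyp-b) (solve (m ∷ a ∷ b ∷ []))
    gap<m+2a : m + (m + suc b) < 1 * m + (a + a)
    gap<m+2a = cert 1 3 (sc 2 hyp-a ⊕ sc 2 a<b ⊕ sc 1 hyp-b) (solve (m ∷ a ∷ b ∷ []))
    gap<3a : m + (m + suc b) < a + (a + a)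
    gap<3a = cert 1 9 (sc 4 hyp-a ⊕ sc 5 a<b ⊕ sc 2 hyp-b) (solve (m ∷ a ∷ b ∷ []))
    m+m<m+a : suc (m + m) ≤ m + a
    m+m<m+a = cert 1 5 (sc 2 hyp-a ⊕ sc 3 a<b ⊕ sc 1 hyp-b) (solve (m ∷ a ∷ b ∷ []))
    3m<2a : suc (m + (m + m)) ≤ a + a
    3m<2a = cert 1 0 (sc 1 hyp-a) (solve (m ∷ a ∷ b ∷ []))
    a+b<2b : a + suc b ≤ b + b
    a+b<2b = cert 1 0 (sc 1 a<b) (solve (m ∷ a ∷ b ∷ []))
    2b<2m+a : suc (b + b) ≤ m + (m + a)
    2b<2m+a = cert 1 2 (sc 1 hyp-a ⊕ sc 1 a<b ⊕ sc 1 hyp-b) (solve (m ∷ a ∷ b ∷ []))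
    4m<m+2a : suc (4 * m) ≤ m + (a + a)
    4m<m+2a = cert 1 0 (sc 1 hyp-a) (solve (m ∷ a ∷ b ∷ []))
    m+2a≤m+2b+1 : m + (a + a) ≤ suc (m + (b + b))
    m+2a≤m+2b+1 = cert 1 3 (sc 2 a<b) (solve (m ∷ a ∷ b ∷ []))
    m+2b<3m+a : suc (m + (b + b)) ≤ 3 * m + a
    m+2b<3m+a = cert 1 2 (sc 1 hyp-a ⊕ sc 1 a<b ⊕ sc 1 hyp-b) (solve (m ∷ a ∷ b ∷ []))
    3m+a≤3b+1 : 3 * m + a ≤ suc (b + (b + b))
    3m+a≤3b+1 = cert 1 5 (sc 1 hyp-a ⊕ sc 3 a<b) (solve (m ∷ a ∷ b ∷ []))
    3b<5m : suc (b + (b + b)) ≤ 5 * m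
    3b<5m = cert 1 0 (sc 1 hyp-b) (solve (m ∷ a ∷ b ∷ []))
    4m<5m : suc (4 * m) ≤ 5 * m
    4m<5m = cert 1 10 (sc 1 11≤m) (solve (m ∷ a ∷ b ∷ []))
    4m<m+2b+1 : 4 * m < suc (m + (b + b))
    4m<m+2b+1 = cert 1 3 (sc 1 hyp-a ⊕ sc 2 a<b) (solve (m ∷ a ∷ b ∷ []))
    4m<3b+1 : 4 * m < suc (b + (b + b))
    4m<3b+1 = cert 1 10 (sc 3 hyp-a ⊕ sc 6 a<b ⊕ sc 1 hyp-b) (solve (m ∷ a ∷ b ∷ []))
    m+2a≤5m : m + (a + a) ≤ 5 * m
    m+2a≤5m = cert 1 10 (sc 2 hyp-a ⊕ sc 6 a<b ⊕ sc 2 hyp-b) (solve (m ∷ a ∷ b ∷ []))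
    3m+a≤5m : 3 * m + a ≤ 5 * m
    3m+a≤5m = cert 1 5 (sc 1 hyp-a ⊕ sc 3 a<b ⊕ sc 1 hyp-b) (solve (m ∷ a ∷ b ∷ []))

  gs : List ℕ
  gs = m ∷ A

  S : ℕ → Set
  S = ⟨ gs ⟩[ 4 * m ]

  Rep : ℕ → Set
  Rep = Comb gs

  rep-+ : ∀ {x y} → Rep x → Rep y → Rep (x + y)
  rep-+ comb-zero ry = ry
  rep-+ {y = y} (comb-add {g} {x} g∈ rx) ry =
    subst Rep (sym (+-assoc g x y)) (comb-add g∈ (rep-+ rx ry))

  rep-gen : ∀ {g} → g ∈ gs → Rep g
  rep-gen {g} g∈ = subst Rep (+-identityʳ g) (comb-add g∈ comb-zero)

  rep-m+ : ∀ {x} → Rep x → Rep (m + x)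
  rep-m+ = comb-add (here refl)

  rep-A : ∀ {y} → y ∈ A → Rep y
  rep-A y∈ = rep-gen (there y∈)

  gen≥m : ∀ {g} → g ∈ gs → m ≤ g
  gen≥m (here refl) = ≤-refl
  gen≥m {g} (there g∈) = ≤-trans (<⇒≤ m<a) (a≤A g g∈)

  rep≥m : ∀ {x} → Rep x → 0 < x → m ≤ x
  rep≥m (comb-add {g} {x} g∈ _) _ = ≤-trans (gen≥m g∈) (m≤m+n g x)

  S≥m : ∀ {x} → S x → 0 < x → m ≤ x
  S≥m (inj₁ rx)   0<x = rep≥m rx 0<x
  S≥m (inj₂ 4m≤x) _   = ≤-trans (m≤n*m m 4) 4m≤x

  data Shape (x : ℕ) : Set where
    m-only  : ∀ i → i ≤ 4 → x ≡ i * m → Shape x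
    one-A   : ∀ i y → i ≤ 3 → y ∈ A → x ≡ i * m + y → Shape x
    two-A   : ∀ i y z → i ≤ 1 → y ∈ A → z ∈ A → x ≡ i * m + (y + z) → Shape x
    three-A : ∀ y z w → y ∈ A → z ∈ A → w ∈ A → x ≡ y + (z + w) → Shape x

  -- Induction on the representation: adding a generator to a shape either gives
  -- another shape or exceeds 5m.
  shape : ∀ {x} → Rep x → x < 5 * m → Shape x
  shape comb-zero _ = m-only 0 z≤n refl
  shape (comb-add {_} {x} (here refl) r) lt with shape r (≤-trans (s≤s (m≤n+m x m)) lt)
  ... | m-only i p e with ≤-suc-cases p
  ...   | inj₁ q    = m-only (suc i) (s≤s q) (cong (m +_) e)
  ...   | inj₂ refl = ⊥-elim (<-irrefl (cong (m +_) e) lt)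
  shape (comb-add (here refl) r) lt | one-A i y p y∈ e with ≤-suc-cases p
  ...   | inj₁ q    = one-A (suc i) y (s≤s q) y∈ (trans (cong (m +_) e) (sym (+-assoc m (i * m) y)))
  ...   | inj₂ refl = ⊥-elim (<-≤-≤-absurd lt 5m≤m+[3m+a]
                        (≥-via (cong (m +_) e) (+-monoʳ-≤ m (+-monoʳ-≤ (3 * m) (a≤A y y∈)))))
  shape (comb-add (here refl) r) lt | two-A i y z p y∈ z∈ e with ≤-suc-cases p
  ...   | inj₁ z≤n  = two-A 1 y z ≤-refl y∈ z∈
                        (trans (cong (m +_) e) (cong (_+ (y + z)) (sym (+-identityʳ m))))
  ...   | inj₂ refl = ⊥-elim (<-≤-≤-absurd lt 5m≤m+[m+2a] (≥-via (cong (m +_) e)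
                        (+-monoʳ-≤ m (+-monoʳ-≤ (1 * m) (+-mono-≤ (a≤A y y∈) (a≤A z z∈))))))
  shape (comb-add (here refl) r) lt | three-A y z w y∈ z∈ w∈ e =
    ⊥-elim (<-≤-≤-absurd lt 5m≤m+3a (≥-via (cong (m +_) e)
      (+-monoʳ-≤ m (+-mono-≤ (a≤A y y∈) (+-mono-≤ (a≤A z z∈) (a≤A w w∈))))))
  shape (comb-add {g} {x} (there g∈) r) lt with shape r (≤-trans (s≤s (m≤n+m x g)) lt)
  ... | m-only i p e with ≤-suc-cases p
  ...   | inj₁ q    = one-A i g q g∈ (trans (cong (g +_) e) (+-comm g (i * m)))
  ...   | inj₂ refl = ⊥-elim (<-≤-≤-absurd lt 5m≤a+4m
                        (≥-via (cong (g +_) e) (+-monoˡ-≤ (4 * m) (a≤A g g∈))))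
  shape (comb-add {g} (there g∈) r) lt | one-A i y p y∈ e with i ≤? 1
  ...   | yes q = two-A i g y q g∈ y∈ (trans (cong (g +_) e) (+-left-swap g (i * m) y))
  ...   | no  q = ⊥-elim (<-≤-≤-absurd lt 5m≤a+[2m+a] (≥-via (cong (g +_) e)
                    (+-mono-≤ (a≤A g g∈) (+-mono-≤ (*-monoˡ-≤ m (≰⇒> q)) (a≤A y y∈)))))
  shape (comb-add {g} (there g∈) r) lt | two-A i y z p y∈ z∈ e with ≤-suc-cases p
  ...   | inj₁ z≤n  = three-A g y z g∈ y∈ z∈ (cong (g +_) e)
  ...   | inj₂ refl = ⊥-elim (<-≤-≤-absurd lt 5m≤a+[m+2a] (≥-via (cong (g +_) e)
                        (+-mono-≤ (a≤A g g∈) (+-monoʳ-≤ (1 * m) (+-mono-≤ (a≤A y y∈) (a≤A z z∈))))))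
  shape (comb-add {g} (there g∈) r) lt | three-A y z w y∈ z∈ w∈ e =
    ⊥-elim (<-≤-≤-absurd lt 5m≤4a (≥-via (cong (g +_) e)
      (+-mono-≤ (a≤A g g∈) (+-mono-≤ (a≤A y y∈) (+-mono-≤ (a≤A z z∈) (a≤A w w∈))))))

  data Upper (x : ℕ) : Set where
    3m+A  : ∀ y → y ∈ A → x ≡ 3 * m + y → Upper x
    m+A+A : ∀ y z → y ∈ A → z ∈ A → x ≡ m + (y + z) → Upper x
    A+A+A : ∀ y z w → y ∈ A → z ∈ A → w ∈ A → x ≡ y + (z + w) → Upper x

  -- Shapes with few A-summands stay at or below 4m (as b ≤ 2m - 2 and 2b ≤ 4m).
  upper : ∀ {x} → Shape x → 4 * m < x → Upper x
  upper (m-only i p e) lt = ⊥-elim (<-≤-≤-absurd lt (≤-via e (*-monoˡ-≤ m p)) ≤-refl)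
  upper (one-A i y p y∈ e) lt with ≤-suc-cases p
  ... | inj₂ refl = 3m+A y y∈ e
  ... | inj₁ q    = ⊥-elim (<-≤-≤-absurd lt
                      (≤-trans (≤-via e (+-mono-≤ (*-monoˡ-≤ m q) (A≤b y y∈))) 2m+b≤4m) ≤-refl)
  upper (two-A i y z p y∈ z∈ e) lt with ≤-suc-cases p
  ... | inj₂ refl = m+A+A y z y∈ z∈ (trans e (cong (_+ (y + z)) (+-identityʳ m)))
  ... | inj₁ z≤n  = ⊥-elim (<-≤-≤-absurd lt
                      (≤-trans (≤-via e (+-mono-≤ (A≤b y y∈) (A≤b z z∈))) b+b≤4m) ≤-refl)
  upper (three-A y z w y∈ z∈ w∈ e) _ = A+A+A y z w y∈ z∈ w∈ e

  D : List ℕ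
  D = map (3 * m +_) A ++ (map (m +_) (pairSums A) ++ tripleSums A)

  length-D : length D ≡ length A + (pairCount (length A) + tripleCount (length A))
  length-D = trans (length-++ (map (3 * m +_) A)) (cong₂ _+_ (length-map (3 * m +_) A)
    (trans (length-++ (map (m +_) (pairSums A)))
      (cong₂ _+_ (trans (length-map (m +_) (pairSums A)) (length-pairSums A)) (length-tripleSums A))))

  upper∈D : ∀ {x} → Upper x → x ∈ D
  upper∈D (3m+A y y∈ refl) = ∈-++⁺ˡ (∈-map⁺ (3 * m +_) y∈)
  upper∈D (m+A+A y z y∈ z∈ refl) =
    ∈-++⁺ʳ (map (3 * m +_) A) (∈-++⁺ˡ (∈-map⁺ (m +_) (∈-pairSums A y∈ z∈)))
  upper∈D (A+A+A y z w y∈ z∈ w∈ refl) =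
    ∈-++⁺ʳ (map (3 * m +_) A) (∈-++⁺ʳ (map (m +_) (pairSums A)) (∈-tripleSums A y∈ z∈ w∈))

  upper-range : ∀ {x} → Upper x →
    (m + (a + a) ≤ x × x ≤ m + (b + b)) ⊎ (3 * m + a ≤ x × x ≤ b + (b + b))
  upper-range (3m+A y y∈ e) = inj₂
    ( ≥-via e (+-monoʳ-≤ (3 * m) (a≤A y y∈))
    , ≤-trans (≤-via e (+-monoʳ-≤ (3 * m) (A≤b y y∈))) 3m+b≤3b )
  upper-range (m+A+A y z y∈ z∈ e) = inj₁
    ( ≥-via e (+-monoʳ-≤ m (+-mono-≤ (a≤A y y∈) (a≤A z z∈)))
    , ≤-via e (+-monoʳ-≤ m (+-mono-≤ (A≤b y y∈) (A≤b z z∈))) )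
  upper-range (A+A+A y z w y∈ z∈ w∈ e) = inj₂
    ( ≤-trans 3m+a≤3a (≥-via e (+-mono-≤ (a≤A y y∈) (+-mono-≤ (a≤A z z∈) (a≤A w w∈))))
    , ≤-via e (+-mono-≤ (A≤b y y∈) (+-mono-≤ (A≤b z z∈) (A≤b w w∈))) )

  InBand : ℕ → Set
  InBand x = x < m + (a + a) ⊎ (m + (b + b) < x × x < 3 * m + a) ⊎ b + (b + b) < x

  upper∉band : ∀ {x} → Upper x → InBand x → ⊥
  upper∉band u band with upper-range u | band
  ... | inj₁ (l , _) | inj₁ x<      = <-≤-≤-absurd x< l ≤-refl
  ... | inj₂ (l , _) | inj₁ x<      = <-≤-≤-absurd x< (≤-trans m+2a≤3m+a l) ≤-refl
  ... | inj₁ (_ , h) | inj₂ (inj₁ (x> , _)) = <-≤-≤-absurd x> h ≤-refl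
  ... | inj₂ (l , _) | inj₂ (inj₁ (_ , x<)) = <-≤-≤-absurd x< l ≤-refl
  ... | inj₁ (_ , h) | inj₂ (inj₂ x>) = <-≤-≤-absurd x> (≤-trans h m+2b≤3b) ≤-refl
  ... | inj₂ (_ , h) | inj₂ (inj₂ x>) = <-≤-≤-absurd x> h ≤-refl

  -- A nonzero element of S that is not representable lies in [4m, ∞); so any sum
  -- of two nonzero elements that is not representable is ≥ 5m.  Hence:
  primitive-between : ∀ {x} → 4 * m < x → x < 5 * m → ¬ Rep x → Primitive S x
  primitive-between {x} 4m<x x<5m ¬rep = inj₂ (<⇒≤ 4m<x) , ≤-trans (s≤s z≤n) 4m<x , indecomposable
    where
    ≥5m : ∀ {p q} → 4 * m ≤ p → m ≤ q → 5 * m ≤ p + q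
    ≥5m {p} {q} 4m≤p m≤q = subst (_≤ p + q) (+-comm (4 * m) m) (+-mono-≤ 4m≤p m≤q)
    indecomposable : ¬ (∃[ x₁ ] ∃[ x₂ ] (S x₁ × 0 < x₁ × S x₂ × 0 < x₂ × x ≡ x₁ + x₂))
    indecomposable (x₁ , x₂ , inj₂ 4m≤x₁ , _ , s₂ , p₂ , refl) =
      <-≤-≤-absurd x<5m (≥5m 4m≤x₁ (S≥m s₂ p₂)) ≤-refl
    indecomposable (x₁ , x₂ , inj₁ r₁ , p₁ , inj₂ 4m≤x₂ , _ , refl) =
      <-≤-≤-absurd x<5m (subst (5 * m ≤_) (+-comm x₂ x₁) (≥5m 4m≤x₂ (rep≥m r₁ p₁))) ≤-refl
    indecomposable (x₁ , x₂ , inj₁ r₁ , _ , inj₁ r₂ , _ , refl) = ¬rep (rep-+ r₁ r₂)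

  outside-D-primitive : ∀ {x} → 4 * m < x → x < 5 * m → x ∉ D → Primitive S x
  outside-D-primitive 4m<x x<5m x∉D =
    primitive-between 4m<x x<5m (λ r → x∉D (upper∈D (upper (shape r x<5m) 4m<x)))

  band-primitive : ∀ {x} → 4 * m < x → x < 5 * m → InBand x → Primitive S x
  band-primitive 4m<x x<5m band =
    primitive-between 4m<x x<5m (λ r → upper∉band (upper (shape r x<5m) 4m<x) band)

  -- m and the elements of A are primitive: a sum of two nonzero elements is ≥ 2m > b.
  m-primitive : Primitive S m
  m-primitive = inj₁ (rep-gen (here refl)) , 0<m , indecomposable
    where
    indecomposable : ¬ (∃[ x₁ ] ∃[ x₂ ] (S x₁ × 0 < x₁ × S x₂ × 0 < x₂ × m ≡ x₁ + x₂))
    indecomposable (_ , _ , s₁ , p₁ , s₂ , p₂ , e) = <-≤-≤-absurd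
      (subst (_< m + m) (+-identityʳ m) (+-monoʳ-< m 0<m))
      (+-mono-≤ (S≥m s₁ p₁) (S≥m s₂ p₂)) (≤-reflexive (sym e))

  A-primitive : ∀ {y} → y ∈ A → Primitive S y
  A-primitive {y} y∈ = inj₁ (rep-A y∈) , ≤-trans 0<m (≤-trans (<⇒≤ m<a) (a≤A y y∈)) , indecomposable
    where
    indecomposable : ¬ (∃[ x₁ ] ∃[ x₂ ] (S x₁ × 0 < x₁ × S x₂ × 0 < x₂ × y ≡ x₁ + x₂))
    indecomposable (_ , _ , s₁ , p₁ , s₂ , p₂ , e) = <-≤-≤-absurd (s≤s (A≤b y y∈))
      (≤-trans b<m+m (+-mono-≤ (S≥m s₁ p₁) (S≥m s₂ p₂))) (≤-reflexive (sym e))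

  gap : ℕ
  gap = m + (m + suc b)

  2m+b<gap : m + (m + b) < gap
  2m+b<gap = +-monoʳ-< m (+-monoʳ-< m ≤-refl)

  -- Each shape is either at most 2m + b or exceeds the gap.
  gap∉S : ¬ S gap
  gap∉S (inj₂ 4m≤gap) = <-irrefl refl (≤-trans gap<4m 4m≤gap)
  gap∉S (inj₁ r) with shape r (≤-trans gap<4m 4m≤5m)
  ... | m-only i p e with ≤-suc-cases p
  ...   | inj₁ q    = <-≤-≤-absurd 2m+b<gap (≤-trans (≤-via e (*-monoˡ-≤ m q)) 3m≤2m+b) ≤-refl
  ...   | inj₂ refl = <-≤-≤-absurd gap<4m (≤-reflexive (sym e)) ≤-refl
  gap∉S (inj₁ r) | one-A i y p y∈ e with i ≤? 2
  ...   | yes q = <-≤-≤-absurd 2m+b<gap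
                    (≤-trans (≤-via e (+-mono-≤ (*-monoˡ-≤ m q) (A≤b y y∈))) 2m+b≤m+[m+b]) ≤-refl
  ...   | no  q = <-≤-≤-absurd gap<3m+a
                    (≥-via e (+-mono-≤ (*-monoˡ-≤ m (≰⇒> q)) (a≤A y y∈))) ≤-refl
  gap∉S (inj₁ r) | two-A i y z p y∈ z∈ e with ≤-suc-cases p
  ...   | inj₁ z≤n  = <-≤-≤-absurd 2m+b<gap
                        (≤-trans (≤-via e (+-mono-≤ (A≤b y y∈) (A≤b z z∈))) b+b≤m+[m+b]) ≤-refl
  ...   | inj₂ refl = <-≤-≤-absurd gap<m+2a
                        (≥-via e (+-monoʳ-≤ (1 * m) (+-mono-≤ (a≤A y y∈) (a≤A z z∈)))) ≤-refl
  gap∉S (inj₁ r) | three-A y z w y∈ z∈ w∈ e = <-≤-≤-absurd gap<3a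
    (≥-via e (+-mono-≤ (a≤A y y∈) (+-mono-≤ (a≤A z z∈) (a≤A w w∈)))) ≤-refl

  conductor≤4m : ∀ {c} → IsConductor S c → c ≤ 4 * m
  conductor≤4m (_ , least) = least (4 * m) (λ _ 4m≤x → inj₂ 4m≤x)

  gap<conductor : ∀ {c} → IsConductor S c → gap < c
  gap<conductor {c} (above , _) with c ≤? gap
  ... | yes c≤gap = ⊥-elim (gap∉S (above gap c≤gap))
  ... | no  c≰gap = ≰⇒> c≰gap

  A-block : Block a (suc b) A
  A-block = record
    { lo≤hi = ≤-trans (<⇒≤ a<b) (n≤1+n b) ; unique = A-unique
    ; range = λ {x} x∈ → a≤A x x∈ , s≤s (A≤b x x∈) }

  -- Small elements: 0, m, A, 2m, m + A, 3m, a + A, 2b, 2m + A, all below the gap.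
  small : List ℕ
  small = 0 ∷ m ∷ A ++ (m + m) ∷ map (m +_) A ++ (m + (m + m)) ∷ map (a +_) A
            ++ (b + b) ∷ map (m +_) (map (m +_) A)

  small-block : Block 0 gap small
  small-block =
    single 0 ⧺⟨ 0<m ⟩ single m ⧺⟨ m<a ⟩ A-block ⧺⟨ b<m+m ⟩ single (m + m) ⧺⟨ m+m<m+a ⟩
    shift m A-block ⧺⟨ +-monoʳ-≤ m b<m+m ⟩ single (m + (m + m)) ⧺⟨ 3m<2a ⟩
    shift a A-block ⧺⟨ a+b<2b ⟩ single (b + b) ⧺⟨ 2b<2m+a ⟩ shift m (shift m A-block)

  small-rep : All Rep small
  small-rep = comb-zero All.∷ rep-m All.∷ AllP.++⁺ rep-As
    (rep-m+ rep-m All.∷ AllP.++⁺ (AllP.map⁺ (All.map rep-m+ rep-As))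
    (rep-m+ (rep-m+ rep-m) All.∷ AllP.++⁺ (AllP.map⁺ (All.map (rep-+ (rep-A a∈A)) rep-As))
    (rep-+ (rep-A b∈A) (rep-A b∈A) All.∷ AllP.map⁺ (AllP.map⁺ (All.map (λ r → rep-m+ (rep-m+ r)) rep-As)))))
    where
    rep-m : Rep m
    rep-m = rep-gen (here refl)
    rep-As : All Rep A
    rep-As = All.tabulate rep-A

  length-small : length small ≡ 5 + 4 * length A
  length-small = trans (cong (2 +_) (trans (length-++ A) (cong (λ t → length A + suc t)
    (trans (length-map-++ (m +_) A) (cong (λ t → length A + suc t)
    (trans (length-map-++ (a +_) A) (cong (λ t → length A + suc t)
    (trans (length-map (m +_) (map (m +_) A)) (length-map (m +_) A)))))))))
    (five-plus-four (length A))
    where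
    five-plus-four : ∀ k → 2 + (k + suc (k + suc (k + suc k))) ≡ 5 + 4 * k
    five-plus-four = solve-∀

  bands : List ℕ
  bands = interval (suc (4 * m)) (m + (a + a)) ++ interval (suc (m + (b + b))) (3 * m + a)
            ++ interval (suc (b + (b + b))) (5 * m)

  bands-block : Block (suc (4 * m)) (5 * m) bands
  bands-block =
    interval-block 4m<m+2a ⧺⟨ m+2a≤m+2b+1 ⟩ interval-block m+2b<3m+a ⧺⟨ 3m+a≤3b+1 ⟩
    interval-block 3b<5m

  bands-primitive : All (Primitive S) bands
  bands-primitive = AllP.++⁺ (in-band₁) (AllP.++⁺ in-band₂ in-band₃)
    where
    in-band₁ : All (Primitive S) (interval (suc (4 * m)) (m + (a + a)))
    in-band₁ = All.tabulate λ p → let (l , u) = ∈-interval⁻ p in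
      band-primitive l (≤-trans u m+2a≤5m) (inj₁ u)
    in-band₂ : All (Primitive S) (interval (suc (m + (b + b))) (3 * m + a))
    in-band₂ = All.tabulate λ p → let (l , u) = ∈-interval⁻ p in
      band-primitive (<-≤-trans 4m<m+2b+1 l) (≤-trans u 3m+a≤5m) (inj₂ (inj₁ (l , u)))
    in-band₃ : All (Primitive S) (interval (suc (b + (b + b))) (5 * m))
    in-band₃ = All.tabulate λ p → let (l , u) = ∈-interval⁻ p in
      band-primitive (<-≤-trans 4m<3b+1 l) u (inj₂ (inj₂ l))

  -- Six times the total band length exceeds m: it equals 4m + 3a - 5b - 3 with
  -- 2a ≥ 3m + 1 and 3b ≤ 5m - 1.
  bands-long : suc m ≤ 6 * length bands
  bands-long = subst (λ t → suc m ≤ 6 * t) (sym length-bands)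
    (six-times _ _ _ (m∸n+n≡m 4m<m+2a) (m∸n+n≡m m+2b<3m+a) (m∸n+n≡m 3b<5m))
    where
    length-bands : length bands ≡ (m + (a + a) ∸ suc (4 * m))
      + ((3 * m + a ∸ suc (m + (b + b))) + (5 * m ∸ suc (b + (b + b))))
    length-bands =
      trans (length-++ (interval (suc (4 * m)) (m + (a + a))))
        (cong₂ _+_ (length-interval (suc (4 * m)) (m + (a + a)))
          (trans (length-++ (interval (suc (m + (b + b))) (3 * m + a)))
            (cong₂ _+_ (length-interval (suc (m + (b + b))) (3 * m + a))
                       (length-interval (suc (b + (b + b))) (5 * m)))))
    six-times : ∀ I₁ I₂ I₃ → I₁ + suc (4 * m) ≡ m + (a + a) → I₂ + suc (m + (b + b)) ≡ 3 * m + a →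
                I₃ + suc (b + (b + b)) ≡ 5 * m → suc m ≤ 6 * (I₁ + (I₂ + I₃))
    six-times I₁ I₂ I₃ E₁ E₂ E₃ = cert 1 0 (sc 9 hyp-a ⊕ sc 10 hyp-b ⊕ sc 6 (≤-reflexive (sym E₁))
      ⊕ sc 6 (≤-reflexive (sym E₂)) ⊕ sc 6 (≤-reflexive (sym E₃))) (solve (m ∷ a ∷ b ∷ I₁ ∷ I₂ ∷ I₃ ∷ []))

  window : List ℕ
  window = interval (suc (4 * m)) (5 * m)

  length-window : length window ≡ m ∸ 1
  length-window = begin
    length window                 ≡⟨ length-interval (suc (4 * m)) (5 * m) ⟩
    5 * m ∸ suc (4 * m)           ≡⟨ cong₂ _∸_ (+-comm m (4 * m)) (+-comm 1 (4 * m)) ⟩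
    (4 * m + m) ∸ (4 * m + 1)     ≡⟨ [m+n]∸[m+o]≡n∸o (4 * m) m 1 ⟩
    m ∸ 1                         ∎
    where open ≡-Reasoning

  F : List ℕ
  F = outside D window

  F-primitive : All (Primitive S) F
  F-primitive = All.tabulate λ {x} p →
    let (x∈ , x∉D) = ∈-filter⁻ (_∉? D) {xs = window} p
        (l , u) = ∈-interval⁻ x∈
    in outside-D-primitive l u x∉D

  F-long : m ≤ suc (length F + (length A + (pairCount (length A) + tripleCount (length A))))
  F-long = ≤-trans (m≤n+m∸n m 1) (s≤s (subst₂ _≤_ length-window (cong (length F +_) length-D)
    (length-outside D (unique (interval-block 4m<5m)))))

  P-bound-bands : ∀ {ps} → Enumerates ps (Primitive S) → suc (length A + length bands) ≤ length ps
  P-bound-bands {ps} enum = subst (_≤ length ps) (cong suc (length-++ A))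
    (enumeration-bound enum (unique (single m ⧺⟨ m<a ⟩ A-block ⧺⟨ s≤s b≤4m ⟩ bands-block))
      (m-primitive All.∷ AllP.++⁺ (All.tabulate A-primitive) bands-primitive))

  P-bound-F : ∀ {ps} → Enumerates ps (Primitive S) → suc (length A + length F) ≤ length ps
  P-bound-F {ps} enum = subst (_≤ length ps) (cong suc (length-++ A))
    (enumeration-bound enum
      (unique (single m ⧺⟨ m<a ⟩ A-block ⧺⟨ s≤s b≤4m ⟩ outside-block D (interval-block 4m<5m)))
      (m-primitive All.∷ AllP.++⁺ (All.tabulate A-primitive) F-primitive))

  L-bound : ∀ {c ls} → IsConductor S c → Enumerates ls (SmallElt S c) → 5 + 4 * length A ≤ length ls
  L-bound {c} {ls} conductor enum = subst (_≤ length ls) length-small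
    (enumeration-bound enum (unique small-block) (All.tabulate λ p →
      inj₁ (All.lookup small-rep p) , <-trans (proj₂ (range small-block p)) (gap<conductor conductor)))

proposition4p1 : (m a b n : ℕ) → .{{_ : NonZero m}} → 0 < a → 0 < b → 3 ≤ n →
    3 * m + 1 ≤ 2 * a → a < b → 3 * b + 1 ≤ 5 * m →
    (A : List ℕ) → Unique A → (∀ x → x ∈ A → 0 < x) → length A ≡ n ∸ 1 →
    a ∈ A → (∀ x → x ∈ A → a ≤ x) → b ∈ A → (∀ x → x ∈ A → x ≤ b) →
    InducesB₃ m A →
    W≥ ⟨ m ∷ A ⟩[ 4 * m ] 9
proposition4p1 m a b n _ _ 3≤n hyp-a a<b hyp-b A A-unique _ |A|≡n-1 a∈A a≤A b∈A A≤b _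
               c ps ls conductor enumP enumL =
  ≤-trans (+-monoˡ-≤ 9 (conductor≤4m conductor))
    (final-count m (length A) (length ps) (length ls) (length F) (length bands)
      2≤|A| bands-long (P-bound-bands enumP) (P-bound-F enumP) F-long (L-bound conductor enumL))
  where
  open Semigroup m a b A hyp-a a<b hyp-b A-unique a∈A b∈A a≤A A≤b
  2≤|A| : 2 ≤ length A
  2≤|A| = subst (2 ≤_) (sym |A|≡n-1) (∸-monoˡ-≤ 1 3≤n)
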